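{- Let $G$ be a (finite, connected) square grid graph and fix any good labeling of $G$. Then there exists a word $w$ that $12$-represents the resulting labeled graph.
   Context: The grid graph is the infinite graph on $\mathbb{Z}^2$ with vertices adjacent iff at Euclidean distance $1$. A square of an induced subgraph $H$ of it is a set of four vertices of $H$ of the form $\{(x,y),(x+1,y),(x,y+1),(x+1,y+1)\}$. A square grid graph is a finite connected induced subgraph of the grid graph in which every vertex and edge lies in some square of it. A labeled graph has distinct positive integers as vertices. A word $w$ (over positive integers) $12$-represents a labeled graph $G=(V,E)$ if the set of letters of $w$ is $V$ and for all distinct $x,y\in V$: $xy\notin E$ iff some occurrence of $\min(x,y)$ precedes some occurrence of $\max(x,y)$ in $w$. A labeling of a graph is good if it has none of the following: (i) labels $p<q<r$ whose induced subgraph has exactly the edges $pq, qr$; (ii) labels $p<q<r<s$ whose induced subgraph has exactly the edges $pr, qs$; (iii) labels $p<q<r<s$ whose induced subgraph has exactly the edges $ps, qr$. -}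

module Defs where

open import Data.Nat as ℕ using (ℕ; _<_)
open import Data.Integer as ℤ using (ℤ; +_; _-_; _*_; _+_)
open import Data.Product using (_×_; _,_; ∃; ∃-syntax; Σ-syntax)
open import Data.List using (List; []; _∷_; length; lookup)
open import Data.List.Membership.Propositional using (_∈_)
open import Data.Fin as Fin using (Fin)
open import Relation.Binary.PropositionalEquality using (_≡_)
open import Relation.Nullary using (¬_)
open import Function.Bundles using (_⇔_)

Pt : Set
Pt = ℤ × ℤ

Adj : Pt → Pt → Set
Adj (x₁ , y₁) (x₂ , y₂) = (x₁ - x₂) * (x₁ - x₂) + (y₁ - y₂) * (y₁ - y₂) ≡ + 1

squarePts : ℤ → ℤ → List Pt
squarePts x y = (x , y) ∷ (x + + 1 , y) ∷ (x , y + + 1) ∷ (x + + 1 , y + + 1) ∷ []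

IsSquareOf : List Pt → ℤ → ℤ → Set
IsSquareOf V x y = ∀ {p} → p ∈ squarePts x y → p ∈ V

data Reach (V : List Pt) : Pt → Pt → Set where
  here : ∀ {u} → Reach V u u
  step : ∀ {u w v} → w ∈ V → Adj u w → Reach V w v → Reach V u v

Connected : List Pt → Set
Connected V = ∀ {u v} → u ∈ V → v ∈ V → Reach V u v

-- A square grid graph: finite (a list of vertices) connected induced subgraph
-- of the grid graph in which every vertex and every edge lies in a square of it.
record SquareGridGraph (V : List Pt) : Set where
  field
    connected  : Connected V
    vertexSq   : ∀ {u} → u ∈ V →
                 ∃[ x ] ∃[ y ] (IsSquareOf V x y × u ∈ squarePts x y)
    edgeSq     : ∀ {u v} → u ∈ V → v ∈ V → Adj u v →
                 ∃[ x ] ∃[ y ] (IsSquareOf V x y × u ∈ squarePts x y × v ∈ squarePts x y)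

record Labeling (V : List Pt) (ℓ : Pt → ℕ) : Set where
  field
    positive  : ∀ {u} → u ∈ V → 0 < ℓ u
    injective : ∀ {u v} → u ∈ V → v ∈ V → ℓ u ≡ ℓ v → u ≡ v

-- Good labeling (conditions (i)-(iii), stated via the vertices carrying the labels).
record Good (V : List Pt) (ℓ : Pt → ℕ) : Set where
  field
    noI   : ∀ {p q r} → p ∈ V → q ∈ V → r ∈ V →
            ℓ p < ℓ q → ℓ q < ℓ r →
            ¬ (Adj p q × Adj q r × ¬ Adj p r)
    noII  : ∀ {p q r s} → p ∈ V → q ∈ V → r ∈ V → s ∈ V →
            ℓ p < ℓ q → ℓ q < ℓ r → ℓ r < ℓ s →
            ¬ (Adj p r × Adj q s × ¬ Adj p q × ¬ Adj p s × ¬ Adj q r × ¬ Adj r s)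
    noIII : ∀ {p q r s} → p ∈ V → q ∈ V → r ∈ V → s ∈ V →
            ℓ p < ℓ q → ℓ q < ℓ r → ℓ r < ℓ s →
            ¬ (Adj p s × Adj q r × ¬ Adj p q × ¬ Adj p r × ¬ Adj q s × ¬ Adj r s)

Precedes : ℕ → ℕ → List ℕ → Set
Precedes a b w = ∃[ i ] ∃[ j ] (Fin.toℕ {length w} i < Fin.toℕ j × lookup w i ≡ a × lookup w j ≡ b)

-- w 12-represents the labeled graph (V, ℓ): letters of w are exactly the labels,
-- and for distinct vertices with ℓ u < ℓ v (so min = ℓ u, max = ℓ v):
-- non-adjacent iff some ℓ u precedes some ℓ v in w.
Represents12 : List Pt → (Pt → ℕ) → List ℕ → Set
Represents12 V ℓ w =
  (∀ a → (a ∈ w) ⇔ (∃[ u ] (u ∈ V × ℓ u ≡ a))) ×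
  (∀ {u v} → u ∈ V → v ∈ V → ℓ u < ℓ v → (¬ Adj u v) ⇔ Precedes (ℓ u) (ℓ v) w)

module Submission where

open import Defs
open import Data.Nat as ℕ using (ℕ; zero; suc; _<_; _≤_; z≤n; s≤s; _<?_)
import Data.Nat.Properties as ℕP
open import Data.Integer as ℤ using (ℤ; +_; -[1+_]; _-_; _*_; _+_; ∣_∣)
import Data.Integer.Properties as ℤP
open import Data.Integer.Solver using (module +-*-Solver)
open import Data.Product using (_×_; _,_; proj₁; proj₂; ∃-syntax)
open import Data.Sum using (_⊎_; inj₁; inj₂)
open import Data.Empty using (⊥; ⊥-elim)
open import Data.List using (List; []; _∷_; _++_; map; filter; concatMap; length)
open import Data.List.Relation.Unary.Any using (Any; any?; here; there; index)
open import Data.List.Relation.Unary.Any.Properties using (lookup-index)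
open import Data.List.Relation.Unary.All using (All; all?; _∷_)
import Data.List.Relation.Unary.All as All
open import Data.List.Relation.Unary.All.Properties using (¬All⇒Any¬)
open import Data.List.Relation.Unary.AllPairs using (AllPairs; _∷_)
open import Data.List.Relation.Unary.Linked.Properties using (Linked⇒AllPairs)
open import Data.List.Relation.Binary.Permutation.Propositional.Properties using (∈-resp-↭)
open import Data.List.Relation.Binary.Permutation.Propositional using (↭-sym)
open import Data.List.Membership.Propositional using (_∈_; _∉_; find; lose)
open import Data.List.Membership.Propositional.Properties
  using (∈-++⁺ˡ; ∈-++⁺ʳ; ∈-++⁻; ∈-map⁺; ∈-map⁻; ∈-filter⁺; ∈-filter⁻; ∈-concatMap⁺; ∈-concatMap⁻; ∈-lookup)
import Data.List.Sort as Sort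
import Data.Fin as Fin
open import Relation.Binary.PropositionalEquality
open import Relation.Binary.Definitions using (tri<; tri≈; tri>)
import Relation.Binary.Construct.On as On
open import Relation.Nullary using (¬_; Dec; yes; no)
open import Relation.Nullary.Decidable using (_×-dec_; _→-dec_; ¬?)
open import Level using (0ℓ)
open import Relation.Unary using (Pred; Decidable)
open import Function.Base using (_∘_)
open import Function.Bundles using (mk⇔)

-- Call a vertex LOW if all its neighbours carry larger
-- labels and HIGH otherwise.  Because the grid graph is triangle-free,
-- condition (i) forces the lower end of every edge to be low, so every
-- edge joins a low vertex to a high vertex with a larger label.  The
-- representing word is
--
--     H · H · blk a₁ · … · blk aₖ · L
--
-- where H (resp. L) lists the labels of the high (resp. low) vertices,
-- a₁ … aₖ are the low vertices, and blk a is ℓ a followed by the labels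
-- of the high vertices b > a not adjacent to a.  Each non-edge is
-- witnessed by one of these segments.  An edge u < v must not be
-- witnessed, which requires every block containing ℓ v to precede blk u.
-- Conditions (ii) and (iii) make this requirement a strict partial order
-- on the low vertices (Before), and sorting them by their number of
-- predecessors extends it linearly.

square-diff-sym : ∀ a b → (a - b) * (a - b) ≡ (b - a) * (b - a)
square-diff-sym = solve 2 (λ a b → (a :- b) :* (a :- b) := (b :- a) :* (b :- a)) refl
  where open +-*-Solver

Adj-sym : ∀ {p q} → Adj p q → Adj q p
Adj-sym {x₁ , y₁} {x₂ , y₂} h rewrite square-diff-sym x₂ x₁ | square-diff-sym y₂ y₁ = h

Adj-irrefl : ∀ {p} → ¬ Adj p p
Adj-irrefl {x , y} h rewrite ℤP.+-inverseʳ x | ℤP.+-inverseʳ y with h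
... | ()

Adj? : ∀ p q → Dec (Adj p q)
Adj? (x₁ , y₁) (x₂ , y₂) = _ ℤ.≟ + 1

data IsUnit : ℤ → Set where
  plus-one  : IsUnit (+ 1)
  minus-one : IsUnit -[1+ 0 ]

-- The sum of two units is even, hence never a unit.
unit-sum : ∀ {a b} → IsUnit a → IsUnit b → ¬ IsUnit (a + b)
unit-sum plus-one  plus-one  ()
unit-sum plus-one  minus-one ()
unit-sum minus-one plus-one  ()
unit-sum minus-one minus-one ()

δ : Pt → Pt → ℤ
δ (x₁ , y₁) (x₂ , y₂) = (x₁ - x₂) + (y₁ - y₂)

δ-trans : ∀ p u v → δ p u + δ u v ≡ δ p v
δ-trans (a , b) (c , d) (f , g) =
  solve 6 (λ a b c d f g → ((a :- c) :+ (b :- d)) :+ ((c :- f) :+ (d :- g)) := (a :- f) :+ (b :- g))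
    refl a b c d f g
  where open +-*-Solver

square-abs : ∀ d → d * d ≡ + (∣ d ∣ ℕ.* ∣ d ∣)
square-abs (+ zero)  = refl
square-abs (+ suc n) = refl
square-abs -[1+ n ]  = refl

sum-of-squares-one : ∀ m n → m ℕ.* m ℕ.+ n ℕ.* n ≡ 1 → (m ≡ 1 × n ≡ 0) ⊎ (m ≡ 0 × n ≡ 1)
sum-of-squares-one zero          (suc zero) refl = inj₂ (refl , refl)
sum-of-squares-one (suc zero)    zero       refl = inj₁ (refl , refl)
sum-of-squares-one zero          zero          ()
sum-of-squares-one zero          (suc (suc n)) ()
sum-of-squares-one (suc zero)    (suc n)       ()
sum-of-squares-one (suc (suc m)) n             ()

abs-one : ∀ d → ∣ d ∣ ≡ 1 → IsUnit d
abs-one (+ suc zero) refl = plus-one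
abs-one -[1+ zero ]  refl = minus-one

abs-zero : ∀ d → ∣ d ∣ ≡ 0 → d ≡ + 0
abs-zero (+ zero) refl = refl

-- Adjacent points differ by ±1 in one coordinate and agree in the other,
-- so their taxicab displacement is a unit.
Adj⇒unit-step : ∀ {p q} → Adj p q → IsUnit (δ p q)
Adj⇒unit-step {x₁ , y₁} {x₂ , y₂} h
  rewrite square-abs (x₁ - x₂) | square-abs (y₁ - y₂)
  with sum-of-squares-one ∣ x₁ - x₂ ∣ ∣ y₁ - y₂ ∣ (ℤP.+-injective h)
... | inj₁ (dx , dy) = subst (λ d → IsUnit (x₁ - x₂ + d)) (sym (abs-zero (y₁ - y₂) dy))
                         (subst IsUnit (sym (ℤP.+-identityʳ (x₁ - x₂))) (abs-one (x₁ - x₂) dx))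
... | inj₂ (dx , dy) = subst (λ d → IsUnit (d + (y₁ - y₂))) (sym (abs-zero (x₁ - x₂) dx))
                         (subst IsUnit (sym (ℤP.+-identityˡ (y₁ - y₂))) (abs-one (y₁ - y₂) dy))

-- Displacements add along a walk, and a sum of two units is never a unit,
-- so the grid graph has no triangles.
triangle-free : ∀ {p u v} → Adj p u → Adj u v → ¬ Adj p v
triangle-free {p} {u} {v} pu uv pv =
  unit-sum (Adj⇒unit-step {p} {u} pu) (Adj⇒unit-step {u} {v} uv)
    (subst IsUnit (sym (δ-trans p u v)) (Adj⇒unit-step {p} {v} pv))

data Prec {A : Set} (a b : A) : List A → Set where
  first : ∀ {w} → b ∈ w → Prec a b (a ∷ w)
  later : ∀ {x w} → Prec a b w → Prec a b (x ∷ w)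

Precedes⇒Prec : ∀ {a b} w → Precedes a b w → Prec a b w
Precedes⇒Prec (x ∷ w) (Fin.zero , Fin.zero , () , _)
Precedes⇒Prec (x ∷ w) (Fin.zero , Fin.suc j , _ , refl , refl) = first (∈-lookup j)
Precedes⇒Prec (x ∷ w) (Fin.suc i , Fin.suc j , s≤s i<j , p , q) =
  later (Precedes⇒Prec w (i , j , i<j , p , q))

Prec⇒Precedes : ∀ {a b} w → Prec a b w → Precedes a b w
Prec⇒Precedes (x ∷ w) (first b∈w) =
  Fin.zero , Fin.suc (index b∈w) , s≤s z≤n , refl , sym (lookup-index b∈w)
Prec⇒Precedes (x ∷ w) (later p) with Prec⇒Precedes w p
... | i , j , i<j , p₁ , q₁ = Fin.suc i , Fin.suc j , s≤s i<j , p₁ , q₁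

module _ {A : Set} {a b : A} where

  prec-∈ˡ : ∀ {w} → Prec a b w → a ∈ w
  prec-∈ˡ (first _) = here refl
  prec-∈ˡ (later p) = there (prec-∈ˡ p)

  prec-∈ʳ : ∀ {w} → Prec a b w → b ∈ w
  prec-∈ʳ (first b∈w) = there b∈w
  prec-∈ʳ (later p)   = there (prec-∈ʳ p)

  prec-++ : ∀ u {v} → a ∈ u → b ∈ v → Prec a b (u ++ v)
  prec-++ (x ∷ u) (here refl) b∈v = first (∈-++⁺ʳ u b∈v)
  prec-++ (x ∷ u) (there a∈u) b∈v = later (prec-++ u a∈u b∈v)

  prec-++ˡ : ∀ {u} v → Prec a b u → Prec a b (u ++ v)
  prec-++ˡ v (first b∈u) = first (∈-++⁺ˡ b∈u)
  prec-++ˡ v (later p)   = later (prec-++ˡ v p)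

  prec-++ʳ : ∀ u {v} → Prec a b v → Prec a b (u ++ v)
  prec-++ʳ []      p = p
  prec-++ʳ (x ∷ u) p = later (prec-++ʳ u p)

  prec-split : ∀ u {v} → Prec a b (u ++ v) → Prec a b u ⊎ (a ∈ u × b ∈ v) ⊎ Prec a b v
  prec-split []      p = inj₂ (inj₂ p)
  prec-split (x ∷ u) (first b∈uv) with ∈-++⁻ u b∈uv
  ... | inj₁ b∈u = inj₁ (first b∈u)
  ... | inj₂ b∈v = inj₂ (inj₁ (here refl , b∈v))
  prec-split (x ∷ u) (later p) with prec-split u p
  ... | inj₁ q                  = inj₁ (later q)
  ... | inj₂ (inj₁ (a∈u , b∈v)) = inj₂ (inj₁ (there a∈u , b∈v))
  ... | inj₂ (inj₂ q)           = inj₂ (inj₂ q)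

  prec-dropˡ : ∀ u {v} → a ∉ u → Prec a b (u ++ v) → Prec a b v
  prec-dropˡ u a∉u p with prec-split u p
  ... | inj₁ q                = ⊥-elim (a∉u (prec-∈ˡ q))
  ... | inj₂ (inj₁ (a∈u , _)) = ⊥-elim (a∉u a∈u)
  ... | inj₂ (inj₂ q)         = q

  prec-dropʳ : ∀ u {v} → b ∉ v → Prec a b (u ++ v) → Prec a b u
  prec-dropʳ u b∉v p with prec-split u p
  ... | inj₁ q                = q
  ... | inj₂ (inj₁ (_ , b∈v)) = ⊥-elim (b∉v b∈v)
  ... | inj₂ (inj₂ q)         = ⊥-elim (b∉v (prec-∈ʳ q))

prec-concatMap : ∀ {A B : Set} {a b : B} (f : A → List B) {x xs} →
                 x ∈ xs → Prec a b (f x) → Prec a b (concatMap f xs)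
prec-concatMap f {xs = y ∷ xs} (here refl) p = prec-++ˡ (concatMap f xs) p
prec-concatMap f {xs = y ∷ xs} (there x∈xs) p = prec-++ʳ (f y) (prec-concatMap f x∈xs p)

module _ {A : Set} {P Q : Pred A 0ℓ} (P? : Decidable P) (Q? : Decidable Q) where

  count-mono : ∀ xs → (∀ {x} → x ∈ xs → P x → Q x) →
               length (filter P? xs) ≤ length (filter Q? xs)
  count-mono []       P⇒Q = z≤n
  count-mono (x ∷ xs) P⇒Q with P? x | Q? x | count-mono xs (P⇒Q ∘ there)
  ... | yes _  | yes _  | ih = s≤s ih
  ... | yes px | no ¬qx | _  = ⊥-elim (¬qx (P⇒Q (here refl) px))
  ... | no _   | yes _  | ih = ℕP.m≤n⇒m≤1+n ih
  ... | no _   | no _   | ih = ih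

  count-strict : ∀ xs → (∀ {x} → x ∈ xs → P x → Q x) →
                 ∀ {y} → y ∈ xs → Q y → ¬ P y →
                 length (filter P? xs) < length (filter Q? xs)
  count-strict (x ∷ xs) P⇒Q (here refl) qy ¬py with P? x | Q? x
  ... | yes px | _      = ⊥-elim (¬py px)
  ... | no _   | no ¬qy = ⊥-elim (¬qy qy)
  ... | no _   | yes _  = s≤s (count-mono xs (P⇒Q ∘ there))
  count-strict (x ∷ xs) P⇒Q (there y∈xs) qy ¬py
    with P? x | Q? x | count-strict xs (P⇒Q ∘ there) y∈xs qy ¬py
  ... | yes _  | yes _  | ih = s≤s ih
  ... | yes px | no ¬qx | _  = ⊥-elim (¬qx (P⇒Q (here refl) px))
  ... | no _   | yes _  | ih = ℕP.m≤n⇒m≤1+n ih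
  ... | no _   | no _   | ih = ih

module Representation (V : List Pt) (ℓ : Pt → ℕ) (lab : Labeling V ℓ) (good : Good V ℓ) where
  open Labeling lab using (injective)
  open Good good

  labels : {P : Pred Pt 0ℓ} → Decidable P → List ℕ
  labels P? = map ℓ (filter P? V)

  labels⁺ : ∀ {P} (P? : Decidable P) {u} → u ∈ V → P u → ℓ u ∈ labels P?
  labels⁺ P? u∈V pu = ∈-map⁺ ℓ (∈-filter⁺ P? u∈V pu)

  labels⁻ : ∀ {P} (P? : Decidable P) {u} → u ∈ V → ℓ u ∈ labels P? → P u
  labels⁻ {P} P? u∈V m with ∈-map⁻ ℓ m
  ... | b , b∈P , ℓu≡ℓb with ∈-filter⁻ P? b∈P
  ... | b∈V , pb = subst P (injective b∈V u∈V (sym ℓu≡ℓb)) pb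

  Labelled : ℕ → Set
  Labelled n = ∃[ u ] (u ∈ V × ℓ u ≡ n)

  labels-labelled : ∀ {P} (P? : Decidable P) {n} → n ∈ labels P? → Labelled n
  labels-labelled P? m with ∈-map⁻ ℓ m
  ... | b , b∈P , n≡ℓb = b , proj₁ (∈-filter⁻ P? b∈P) , sym n≡ℓb

  Low : Pred Pt 0ℓ
  Low u = All (λ p → Adj u p → ℓ u < ℓ p) V

  low? : Decidable Low
  low? u = all? (λ p → Adj? u p →-dec (ℓ u <? ℓ p)) V

  high? : Decidable (λ u → ¬ Low u)
  high? u = ¬? (low? u)

  low-nbr : ∀ {u p} → Low u → p ∈ V → Adj u p → ℓ u < ℓ p
  low-nbr uL p∈V = All.lookup uL p∈V

  -- A high vertex has a neighbour with a smaller label (labels are distinct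
  -- and no vertex is its own neighbour).
  smaller-nbr : ∀ {u} → u ∈ V → ¬ Low u → ∃[ p ] (p ∈ V × Adj u p × ℓ p < ℓ u)
  smaller-nbr {u} u∈V ¬low with find (¬All⇒Any¬ (λ p → Adj? u p →-dec (ℓ u <? ℓ p)) V ¬low)
  ... | p , p∈V , ¬ascends with Adj? u p | ℕP.<-cmp (ℓ p) (ℓ u)
  ... | no ¬up | _            = ⊥-elim (¬ascends (⊥-elim ∘ ¬up))
  ... | yes up | tri< p<u _ _ = p , p∈V , up , p<u
  ... | yes up | tri≈ _ p≡u _ = ⊥-elim (Adj-irrefl {u} (subst (Adj u) (injective p∈V u∈V p≡u) up))
  ... | yes up | tri> _ _ u<p = ⊥-elim (¬ascends (λ _ → u<p))

  no-ascending-path : ∀ {p q r} → p ∈ V → q ∈ V → r ∈ V → ℓ p < ℓ q → ℓ q < ℓ r →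
                      Adj p q → ¬ Adj p r → ¬ Adj q r
  no-ascending-path p∈V q∈V r∈V p<q q<r pq ¬pr qr = noI p∈V q∈V r∈V p<q q<r (pq , qr , ¬pr)

  -- The lower end of an edge is low: a smaller neighbour p of u would give
  -- the ascending path p u v, and pv is missing as the grid has no triangles.
  edge-low : ∀ {u v} → u ∈ V → v ∈ V → ℓ u < ℓ v → Adj u v → Low u
  edge-low {u} {v} u∈V v∈V u<v uv with low? u
  ... | yes uL = uL
  ... | no ¬uL with smaller-nbr u∈V ¬uL
  ... | p , p∈V , up , p<u =
    ⊥-elim (no-ascending-path p∈V u∈V v∈V p<u u<v pu (triangle-free {p} {u} {v} pu uv) uv)
    where
    pu : Adj p u
    pu = Adj-sym {u} {p} up

  -- Two adjacent low vertices would each lie below the other.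
  low-independent : ∀ {u v} → u ∈ V → v ∈ V → Low u → Low v → ¬ Adj u v
  low-independent {u} {v} u∈V v∈V uL vL uv =
    ℕP.<-asym (low-nbr uL v∈V uv) (low-nbr vL u∈V (Adj-sym {u} {v} uv))

  edge-high : ∀ {u v} → u ∈ V → v ∈ V → ℓ u < ℓ v → Adj u v → ¬ Low v
  edge-high u∈V v∈V u<v uv vL = low-independent u∈V v∈V (edge-low u∈V v∈V u<v uv) vL uv

  -- Conditions (ii) and (iii): if x < y lie below b and c, the induced
  -- subgraph on {x, y, b, c} is not the matching {xc, yb}.
  no-matching : ∀ {x y b c} → x ∈ V → y ∈ V → b ∈ V → c ∈ V →
                ℓ x < ℓ y → ℓ y < ℓ b → ℓ y < ℓ c → Adj x c → Adj y b →
                ¬ Adj x y → ¬ Adj x b → ¬ Adj y c → ¬ Adj b c → ⊥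
  no-matching {x} {y} {b} {c} x∈V y∈V b∈V c∈V x<y y<b y<c xc yb ¬xy ¬xb ¬yc ¬bc
    with ℕP.<-cmp (ℓ b) (ℓ c)
  ... | tri< b<c _ _ = noIII x∈V y∈V b∈V c∈V x<y y<b b<c (xc , yb , ¬xy , ¬xb , ¬yc , ¬bc)
  ... | tri≈ _ b≡c _ = ¬yc (subst (Adj y) (injective b∈V c∈V b≡c) yb)
  ... | tri> _ _ c<b = noII x∈V y∈V c∈V b∈V x<y y<c c<b
                         (xc , yb , ¬xy , ¬xb , ¬yc , ¬bc ∘ Adj-sym {c} {b})

  crossing-tops : ∀ {x y b₁ b₂} → x ∈ V → y ∈ V → b₁ ∈ V → b₂ ∈ V → Low x → Low y →
                  Adj x b₂ → Adj y b₁ → ¬ Adj x b₁ → ¬ Adj y b₂ → ¬ Adj b₁ b₂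
  crossing-tops {x} {y} {b₁} {b₂} x∈V y∈V b₁∈V b₂∈V xL yL xb₂ yb₁ ¬xb₁ ¬yb₂ b₁b₂
    with ℕP.<-cmp (ℓ b₁) (ℓ b₂)
  ... | tri< b₁<b₂ _ _ =
    no-ascending-path y∈V b₁∈V b₂∈V (low-nbr yL b₁∈V yb₁) b₁<b₂ yb₁ ¬yb₂ b₁b₂
  ... | tri≈ _ b₁≡b₂ _ = ¬yb₂ (subst (Adj y) (injective b₁∈V b₂∈V b₁≡b₂) yb₁)
  ... | tri> _ _ b₂<b₁ =
    no-ascending-path x∈V b₂∈V b₁∈V (low-nbr xL b₂∈V xb₂) b₂<b₁ xb₂ ¬xb₁ (Adj-sym {b₁} {b₂} b₁b₂)

  no-crossing : ∀ {x y b₁ b₂} → x ∈ V → y ∈ V → b₁ ∈ V → b₂ ∈ V → Low x → Low y →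
                Adj x b₂ → Adj y b₁ → ¬ Adj x b₁ → ¬ Adj y b₂ → ℓ x < ℓ b₁ → ℓ y < ℓ b₂ → ⊥
  no-crossing {x} {y} {b₁} {b₂} x∈V y∈V b₁∈V b₂∈V xL yL xb₂ yb₁ ¬xb₁ ¬yb₂ x<b₁ y<b₂
    with ℕP.<-cmp (ℓ x) (ℓ y)
  ... | tri< x<y _ _ =
    no-matching x∈V y∈V b₁∈V b₂∈V x<y (low-nbr yL b₁∈V yb₁) y<b₂ xb₂ yb₁
      (low-independent x∈V y∈V xL yL) ¬xb₁ ¬yb₂
      (crossing-tops x∈V y∈V b₁∈V b₂∈V xL yL xb₂ yb₁ ¬xb₁ ¬yb₂)
  ... | tri≈ _ x≡y _ = ¬yb₂ (subst (λ w → Adj w b₂) (injective x∈V y∈V x≡y) xb₂)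
  ... | tri> _ _ y<x =
    no-matching y∈V x∈V b₂∈V b₁∈V y<x (low-nbr xL b₂∈V xb₂) x<b₁ yb₁ xb₂
      (low-independent y∈V x∈V yL xL) ¬yb₂ ¬xb₁
      (crossing-tops y∈V x∈V b₂∈V b₁∈V yL xL yb₁ xb₂ ¬yb₂ ¬xb₁)

  -- Before x a: some vertex b above x and not adjacent to x is adjacent to a.
  -- The block of x will contain ℓ b, so it must come before the block of a.
  Before : Pt → Pt → Set
  Before x a = Any (λ b → ℓ x < ℓ b × ¬ Adj x b × Adj a b) V

  before? : ∀ x a → Dec (Before x a)
  before? x a = any? (λ b → (ℓ x <? ℓ b) ×-dec ¬? (Adj? x b) ×-dec Adj? a b) V

  Before-irrefl : ∀ {x} → ¬ Before x x
  Before-irrefl x≺x with find x≺x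
  ... | b , _ , (_ , ¬xb , xb) = ¬xb xb

  -- On low vertices Before is transitive: a failure of transitivity would
  -- produce one of the crossings excluded by no-crossing.
  Before-trans : ∀ {x y z} → x ∈ V → y ∈ V → z ∈ V → Low x → Low y → Low z →
                 Before x y → Before y z → Before x z
  Before-trans {x} {y} {z} x∈V y∈V z∈V xL yL zL x≺y y≺z with find x≺y | find y≺z
  ... | b₁ , b₁∈V , (x<b₁ , ¬xb₁ , yb₁) | b₂ , b₂∈V , (y<b₂ , ¬yb₂ , zb₂) with Adj? x b₂
  ... | yes xb₂ = ⊥-elim (no-crossing x∈V y∈V b₁∈V b₂∈V xL yL xb₂ yb₁ ¬xb₁ ¬yb₂ x<b₁ y<b₂)
  ... | no ¬xb₂ with ℓ x <? ℓ b₂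
  ...   | yes x<b₂ = lose b₂∈V (x<b₂ , ¬xb₂ , zb₂)
  ...   | no x≮b₂ with Adj? z b₁
  ...     | yes zb₁ = lose b₁∈V (x<b₁ , ¬xb₁ , zb₁)
  ...     | no ¬zb₁ = ⊥-elim (no-crossing z∈V y∈V b₁∈V b₂∈V zL yL zb₂ yb₁ ¬zb₁ ¬yb₂ z<b₁ y<b₂)
    where
    z<b₁ : ℓ z < ℓ b₁
    z<b₁ = ℕP.<-trans (ℕP.<-≤-trans (low-nbr zL b₂∈V zb₂) (ℕP.≮⇒≥ x≮b₂)) x<b₁

  lows : List Pt
  lows = filter low? V

  -- The rank of a low vertex is its number of Before-predecessors; it
  -- strictly increases along Before, so ordering by rank extends Before.
  rank : Pt → ℕ
  rank a = length (filter (λ x → before? x a) lows)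

  -- By transitivity every Before-predecessor of a is one of u, and a itself
  -- is a predecessor of u but not of a.
  rank-mono : ∀ {a u} → a ∈ V → u ∈ V → Low a → Low u → Before a u → rank a < rank u
  rank-mono {a} {u} a∈V u∈V aL uL a≺u =
    count-strict (λ x → before? x a) (λ x → before? x u) lows
      (λ x∈lows x≺a → let x∈V , xL = ∈-filter⁻ low? x∈lows in
                      Before-trans x∈V a∈V u∈V xL aL uL x≺a a≺u)
      (∈-filter⁺ low? a∈V aL) a≺u Before-irrefl

  open Sort (On.decTotalOrder ℕP.≤-decTotalOrder rank) using (sort; sort-↭; sort-↗)

  order : List Pt
  order = sort lows

  order-complete : ∀ {a} → a ∈ V → Low a → a ∈ order
  order-complete a∈V aL = ∈-resp-↭ (↭-sym (sort-↭ lows)) (∈-filter⁺ low? a∈V aL)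

  order-low : All (λ a → a ∈ V × Low a) order
  order-low = All.tabulate (λ a∈order → ∈-filter⁻ low? (∈-resp-↭ (sort-↭ lows) a∈order))

  order-sorted : AllPairs (λ a b → rank a ≤ rank b) order
  order-sorted = Linked⇒AllPairs ℕP.≤-trans (sort-↗ lows)

  Above : Pt → Pt → Set
  Above a b = ¬ Low b × ℓ a < ℓ b × ¬ Adj a b

  above? : ∀ a → Decidable (Above a)
  above? a b = high? b ×-dec (ℓ a <? ℓ b) ×-dec ¬? (Adj? a b)

  block : Pt → List ℕ
  block a = ℓ a ∷ labels (above? a)

  block-low : ∀ {u a} → u ∈ V → a ∈ V → Low u → ℓ u ∈ block a → u ≡ a
  block-low u∈V a∈V uL (here ℓu≡ℓa) = injective u∈V a∈V ℓu≡ℓa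
  block-low u∈V a∈V uL (there m)    = ⊥-elim (proj₁ (labels⁻ (above? _) u∈V m) uL)

  block-high : ∀ {v a} → v ∈ V → a ∈ V → ¬ Low v → Low a → ℓ v ∈ block a → Above a v
  block-high v∈V a∈V ¬vL aL (here ℓv≡ℓa) = ⊥-elim (¬vL (subst Low (injective a∈V v∈V (sym ℓv≡ℓa)) aL))
  block-high v∈V a∈V ¬vL aL (there m)    = labels⁻ (above? _) v∈V m

  -- No edge u < v is witnessed by the blocks of a rank-sorted list of low
  -- vertices: a block containing ℓ v belongs to some a with Before a u, and
  -- so has smaller rank than u.
  blocks-avoid-edge : ∀ {u v} → u ∈ V → v ∈ V → Low u → ¬ Low v → Adj u v →
                      ∀ s → AllPairs (λ a b → rank a ≤ rank b) s → All (λ a → a ∈ V × Low a) s →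
                      ¬ Prec (ℓ u) (ℓ v) (concatMap block s)
  blocks-avoid-edge u∈V v∈V uL ¬vL uv (a ∷ s) (a≤s ∷ sorted) ((a∈V , aL) ∷ lowS) p
    with prec-split (block a) p
  ... | inj₁ q with block-low u∈V a∈V uL (prec-∈ˡ q)
  ...   | refl = proj₂ (proj₂ (block-high v∈V a∈V ¬vL aL (prec-∈ʳ q))) uv
  blocks-avoid-edge u∈V v∈V uL ¬vL uv (a ∷ s) (a≤s ∷ sorted) ((a∈V , aL) ∷ lowS) p
      | inj₂ (inj₁ (u∈block , v∈rest)) with block-low u∈V a∈V uL u∈block
  ...   | refl with find (∈-concatMap⁻ block v∈rest)
  ...     | a′ , a′∈s , v∈block′ =
    let a′∈V , a′L = All.lookup lowS a′∈s
        _ , a′<v , ¬a′v = block-high v∈V a′∈V ¬vL a′L v∈block′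
    in ℕP.<-irrefl refl (ℕP.<-≤-trans (rank-mono a′∈V u∈V a′L uL (lose v∈V (a′<v , ¬a′v , uv)))
                                      (All.lookup a≤s a′∈s))
  blocks-avoid-edge u∈V v∈V uL ¬vL uv (a ∷ s) (a≤s ∷ sorted) ((a∈V , aL) ∷ lowS) p
      | inj₂ (inj₂ q) = blocks-avoid-edge u∈V v∈V uL ¬vL uv s sorted lowS q

  highs middle lowLabels word : List ℕ
  highs     = labels high?
  middle    = concatMap block order
  lowLabels = labels low?
  word      = (highs ++ highs) ++ (middle ++ lowLabels)

  word-labelled : ∀ n → n ∈ word → Labelled n
  word-labelled n m with ∈-++⁻ (highs ++ highs) m
  ... | inj₁ m₁ with ∈-++⁻ highs m₁
  ...   | inj₁ m₂ = labels-labelled high? m₂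
  ...   | inj₂ m₂ = labels-labelled high? m₂
  word-labelled n m | inj₂ m₁ with ∈-++⁻ middle m₁
  ...   | inj₂ m₂ = labels-labelled low? m₂
  ...   | inj₁ m₂ with find (∈-concatMap⁻ block m₂)
  ...     | a , a∈order , here n≡ℓa = a , proj₁ (All.lookup order-low a∈order) , sym n≡ℓa
  ...     | a , _ , there m₃ = labels-labelled (above? a) m₃

  labelled-in-word : ∀ n → Labelled n → n ∈ word
  labelled-in-word n (u , u∈V , refl) with low? u
  ... | yes uL = ∈-++⁺ʳ (highs ++ highs) (∈-++⁺ʳ middle (labels⁺ low? u∈V uL))
  ... | no ¬uL = ∈-++⁺ˡ (∈-++⁺ˡ (labels⁺ high? u∈V ¬uL))

  low-in-middle : ∀ {u} → u ∈ V → Low u → ℓ u ∈ middle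
  low-in-middle u∈V uL = ∈-concatMap⁺ block (lose (order-complete u∈V uL) (here refl))

  nonedge-witnessed : ∀ {u v} → u ∈ V → v ∈ V → ℓ u < ℓ v → ¬ Adj u v → Prec (ℓ u) (ℓ v) word
  nonedge-witnessed {u} {v} u∈V v∈V u<v ¬uv with low? u | low? v
  ... | no ¬uL | no ¬vL =
    prec-++ˡ (middle ++ lowLabels) (prec-++ highs (labels⁺ high? u∈V ¬uL) (labels⁺ high? v∈V ¬vL))
  ... | no ¬uL | yes vL =
    prec-++ (highs ++ highs) (∈-++⁺ˡ (labels⁺ high? u∈V ¬uL)) (∈-++⁺ʳ middle (labels⁺ low? v∈V vL))
  ... | yes uL | yes vL =
    prec-++ʳ (highs ++ highs) (prec-++ middle (low-in-middle u∈V uL) (labels⁺ low? v∈V vL))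
  ... | yes uL | no ¬vL =
    prec-++ʳ (highs ++ highs) (prec-++ˡ lowLabels
      (prec-concatMap block (order-complete u∈V uL) (first (labels⁺ (above? u) v∈V (¬vL , u<v , ¬uv)))))

  -- No edge u < v is witnessed: its lower end u is low and its upper end v is
  -- high, so ℓ u occurs only in the blocks and ℓ v only in H and the blocks.
  edge-unwitnessed : ∀ {u v} → u ∈ V → v ∈ V → ℓ u < ℓ v → Adj u v → ¬ Prec (ℓ u) (ℓ v) word
  edge-unwitnessed u∈V v∈V u<v uv p =
    blocks-avoid-edge u∈V v∈V uL ¬vL uv order order-sorted order-low
      (prec-dropʳ middle (¬vL ∘ labels⁻ low? v∈V)
        (prec-dropˡ (highs ++ highs) u∉highs p))
    where
    uL : Low _
    uL = edge-low u∈V v∈V u<v uv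
    ¬vL : ¬ Low _
    ¬vL = edge-high u∈V v∈V u<v uv
    u∉highs : ℓ _ ∉ highs ++ highs
    u∉highs m with ∈-++⁻ highs m
    ... | inj₁ m₁ = labels⁻ high? u∈V m₁ uL
    ... | inj₂ m₁ = labels⁻ high? u∈V m₁ uL

theorem21 : (V : List Pt) (ℓ : Pt → ℕ) → SquareGridGraph V → Labeling V ℓ → Good V ℓ →
            ∃[ w ] Represents12 V ℓ w
theorem21 V ℓ _ lab good =
  word ,
  (λ n → mk⇔ (word-labelled n) (labelled-in-word n)) ,
  (λ u∈V v∈V u<v → mk⇔ (Prec⇒Precedes word ∘ nonedge-witnessed u∈V v∈V u<v)
                       (λ p uv → edge-unwitnessed u∈V v∈V u<v uv (Precedes⇒Prec word p)))
  where open Representation V ℓ lab good
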